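{- Let $4\le k\le n$ and let $\rho_k^{\mathbb{C}}$ be the complex permutation representation of $S_n$ arising from the action of $S_n$ on ordered $k$-tuples $(i_1,\dots,i_k)$ of distinct elements of $\{1,\dots,n\}$, given by $\pi\cdot(i_1,\dots,i_k)=(\pi(i_1),\dots,\pi(i_k))$. Then there exist $\pi,\sigma\in S_n$ which are not conjugate in $S_n$ but such that $\rho_k^{\mathbb{C}}(\pi)$ and $\rho_k^{\mathbb{C}}(\sigma)$ are similar matrices.
   Context: The permutation representation associated with an action of a group on a finite set $X$ sends a group element to the $|X|\times|X|$ permutation matrix of its action on $X$. -}

module Defs where

open import Level using (Level; _⊔_)
open import Data.Nat using (ℕ; zero; suc)
open import Data.Fin using (Fin; _≟_) renaming (zero to fzero; suc to fsuc)
open import Data.Fin.Properties using (all?)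
open import Data.Fin.Permutation using (Permutation′; _⟨$⟩ʳ_; _⟨$⟩ˡ_; inverseˡ)
open import Data.Vec.Functional using () renaming (_∷_ to _∷ᶠ_)
open import Data.List using (List; []; _∷_; _∷ʳ_)
open import Data.Product using (Σ; ∃; _×_; _,_; proj₁)
open import Relation.Nullary using (¬_; Dec; yes; no)
open import Relation.Nullary.Decidable using (_→-dec_)
open import Relation.Binary.PropositionalEquality using (_≡_; refl; sym; trans; cong)
open import Algebra.Bundles using (CommutativeRing)

Sym : ℕ → Set
Sym n = Permutation′ n

Conjugate : {n : ℕ} → Sym n → Sym n → Set
Conjugate {n} π σ = ∃ λ (τ : Sym n) → ∀ i → σ ⟨$⟩ʳ i ≡ τ ⟨$⟩ʳ (π ⟨$⟩ʳ (τ ⟨$⟩ˡ i))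

Distinct : {k n : ℕ} → (Fin k → Fin n) → Set
Distinct {k} t = ∀ (i j : Fin k) → t i ≡ t j → i ≡ j

distinct? : {k n : ℕ} (t : Fin k → Fin n) → Dec (Distinct t)
distinct? t = all? (λ i → all? (λ j → (t i ≟ t j) →-dec (i ≟ j)))

Tuple : ℕ → ℕ → Set
Tuple k n = Σ (Fin k → Fin n) Distinct

act : {k n : ℕ} → Sym n → Tuple k n → Tuple k n
act π (t , d) = (λ i → π ⟨$⟩ʳ t i) , λ i j e → d i j (lemma e)
  where
  lemma : ∀ {a b} → π ⟨$⟩ʳ a ≡ π ⟨$⟩ʳ b → a ≡ b
  lemma {a} {b} e = trans (sym (inverseˡ π {a})) (trans (cong (π ⟨$⟩ˡ_) e) (inverseˡ π {b}))

sameTuple? : {k n : ℕ} (x y : Tuple k n) → Dec (∀ i → proj₁ x i ≡ proj₁ y i)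
sameTuple? x y = all? (λ i → proj₁ x i ≟ proj₁ y i)

module Matrices {c ℓ} (F : CommutativeRing c ℓ) where
  open CommutativeRing F

  sumFin : (n : ℕ) → (Fin n → Carrier) → Carrier
  sumFin zero    f = 0#
  sumFin (suc n) f = f fzero + sumFin n (λ i → f (fsuc i))

  sumFun : (k n : ℕ) → ((Fin k → Fin n) → Carrier) → Carrier
  sumFun zero    n f = f (λ ())
  sumFun (suc k) n f = sumFin n (λ a → sumFun k n (λ g → f (a ∷ᶠ g)))

  sumX : (k n : ℕ) → (Tuple k n → Carrier) → Carrier
  sumX k n f = sumFun k n (λ t → pick (distinct? t))
    where
    pick : ∀ {t} → Dec (Distinct t) → Carrier
    pick {t} (yes d) = f (t , d)
    pick     (no _)  = 0#

  Mat : ℕ → ℕ → Set c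
  Mat k n = Tuple k n → Tuple k n → Carrier

  _⊗_ : {k n : ℕ} → Mat k n → Mat k n → Mat k n
  _⊗_ {k} {n} A B x z = sumX k n (λ y → A x y * B y z)

  [_] : {A : Set} → Dec A → Carrier
  [ yes _ ] = 1#
  [ no _ ]  = 0#

  Id : {k n : ℕ} → Mat k n
  Id x y = [ sameTuple? x y ]

  _≋_ : {k n : ℕ} → Mat k n → Mat k n → Set ℓ
  A ≋ B = ∀ x y → A x y ≈ B x y

  Similar : {k n : ℕ} → Mat k n → Mat k n → Set (c ⊔ ℓ)
  Similar A B = ∃ λ P → ∃ λ Q → ((P ⊗ Q) ≋ Id) × ((Q ⊗ P) ≋ Id) × (((P ⊗ A) ⊗ Q) ≋ B)

  -- permutation representation ρ_k: ρ(π) e_y = e_{π·y}, i.e. ρ(π)_{x,y} = 1 iff x = π·y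
  ρ : (k : ℕ) {n : ℕ} → Sym n → Mat k n
  ρ k π x y = [ sameTuple? x (act π y) ]

  fromℕ : ℕ → Carrier
  fromℕ zero    = 0#
  fromℕ (suc m) = 1# + fromℕ m

  eval : List Carrier → Carrier → Carrier
  eval []       x = 0#
  eval (a ∷ as) x = a + x * eval as x

  record IsAlgClosedFieldChar0 : Set (c ⊔ ℓ) where
    field
      1≉0       : ¬ (1# ≈ 0#)
      inverse   : ∀ x → ¬ (x ≈ 0#) → ∃ λ y → x * y ≈ 1#
      char0     : ∀ m → ¬ (fromℕ (suc m) ≈ 0#)
      -- every monic polynomial of degree ≥ 1 has a root
      algClosed : ∀ a as → ∃ λ x → eval ((a ∷ as) ∷ʳ 1#) x ≈ 0#

{-# OPTIONS --safe #-}
module Submission where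

-- Take π = (0 1)(2 3)(4 5)⋯ and σ = (0 1)π = (2 3)(4 5)⋯.  σ fixes 0 and 1
-- while π has at most one fixed point, so they are not conjugate.  For the
-- similarity, call one point of each 2-cycle of σ lower and the other upper,
-- and let τ fix a k-tuple whose first entry moved by σ is lower and apply
-- (0 1) to it otherwise.  Since σ has at most three fixed points and k ≥ 4,
-- that entry exists; π swaps lower and upper points while (0 1) preserves
-- them, so τ is an involution of the k-tuples with τ π = σ τ, and its
-- permutation matrix conjugates ρ(π) into ρ(σ).

open import Defs
open import Level using (Level; 0ℓ)
open import Data.Nat using (ℕ; zero; suc; _≤_; _<_; s≤s; 2+)
open import Data.Nat.Properties using (≤-trans)
open import Data.Fin using (Fin; zero; suc)
open import Data.Fin.Properties using (suc-injective; pigeonhole; <⇒≢)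
open import Data.Fin.Permutation using (permutation; _⟨$⟩ʳ_; _⟨$⟩ˡ_; inverseˡ; inverseʳ)
open import Data.Product using (∃; _×_; _,_; proj₁; proj₂)
open import Data.Empty using (⊥-elim)
open import Function using (_∘_; id)
open import Relation.Nullary using (¬_; Dec; yes; no)
open import Relation.Binary.Bundles using (Setoid)
open import Relation.Binary.PropositionalEquality
  using (_≡_; _≢_; _≗_; refl; sym; trans; cong; cong₂; module ≡-Reasoning)
open import Algebra.Bundles using (CommutativeRing)

≗-sym : ∀ {A B : Set} {f g : A → B} → f ≗ g → g ≗ f
≗-sym f≗g a = sym (f≗g a)

≗-trans : ∀ {A B : Set} {f g h : A → B} → f ≗ g → g ≗ h → f ≗ h
≗-trans f≗g g≗h a = trans (f≗g a) (g≗h a)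

-- ≐ only sees the underlying functions, so tuples in implicit positions often
-- have to be supplied by hand.
_≐_ : ∀ {k n} → Tuple k n → Tuple k n → Set
x ≐ y = proj₁ x ≗ proj₁ y

Tuple-setoid : ℕ → ℕ → Setoid 0ℓ 0ℓ
Tuple-setoid k n = record
  { Carrier       = Tuple k n
  ; _≈_           = _≐_
  ; isEquivalence = record
    { refl  = λ _ → refl
    ; sym   = ≗-sym
    ; trans = ≗-trans
    }
  }

act-cong : ∀ {k n} (π : Sym n) {x y : Tuple k n} → x ≐ y → act π x ≐ act π y
act-cong π x≐y i = cong (π ⟨$⟩ʳ_) (x≐y i)

record TupleIntertwiner (k : ℕ) {n : ℕ} (π σ : Sym n) : Set where
  field
    to          : Tuple k n → Tuple k n
    from        : Tuple k n → Tuple k n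
    to-cong     : ∀ {x y} → x ≐ y → to x ≐ to y
    from-cong   : ∀ {x y} → x ≐ y → from x ≐ from y
    to-from     : ∀ x → to (from x) ≐ x
    from-to     : ∀ x → from (to x) ≐ x
    intertwines : ∀ x → to (act π x) ≐ act σ (to x)

module PermutationMatrices {c ℓ} (F : CommutativeRing c ℓ) where
  open CommutativeRing F
    hiding (zero) renaming (refl to ≈-refl; sym to ≈-sym; trans to ≈-trans)
  open Matrices F
  open import Relation.Binary.Reasoning.Setoid setoid

  iverson-yes : ∀ {A : Set} (a? : Dec A) → A → [ a? ] ≈ 1#
  iverson-yes (yes _) _ = ≈-refl
  iverson-yes (no ¬a) a = ⊥-elim (¬a a)

  iverson-no : ∀ {A : Set} (a? : Dec A) → ¬ A → [ a? ] ≈ 0#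
  iverson-no (yes a) ¬a = ⊥-elim (¬a a)
  iverson-no (no _)  _  = ≈-refl

  iverson-cong : ∀ {A B : Set} (a? : Dec A) (b? : Dec B) → (A → B) → (B → A) →
                 [ a? ] ≈ [ b? ]
  iverson-cong (yes a) b? A→B _   = ≈-sym (iverson-yes b? (A→B a))
  iverson-cong (no ¬a) b? _   B→A = ≈-sym (iverson-no b? (¬a ∘ B→A))

  sumFin-zero : ∀ n (f : Fin n → Carrier) → (∀ i → f i ≈ 0#) → sumFin n f ≈ 0#
  sumFin-zero zero    f f≈0 = ≈-refl
  sumFin-zero (suc n) f f≈0 =
    ≈-trans (+-cong (f≈0 zero) (sumFin-zero n (f ∘ suc) (f≈0 ∘ suc))) (+-identityˡ 0#)

  sumFin-delta : ∀ n (f : Fin n → Carrier) (a : Fin n) → (∀ b → b ≢ a → f b ≈ 0#) →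
                 sumFin n f ≈ f a
  sumFin-delta (suc n) f zero    off = begin
    f zero + sumFin n (f ∘ suc) ≈⟨ +-congˡ (sumFin-zero n _ (λ b → off (suc b) λ ())) ⟩
    f zero + 0#                 ≈⟨ +-identityʳ (f zero) ⟩
    f zero                      ∎
  sumFin-delta (suc n) f (suc a) off = begin
    f zero + sumFin n (f ∘ suc) ≈⟨ +-cong (off zero λ ())
                                     (sumFin-delta n _ a λ b b≢a → off (suc b) (b≢a ∘ suc-injective)) ⟩
    0# + f (suc a)              ≈⟨ +-identityˡ (f (suc a)) ⟩
    f (suc a)                   ∎

  sumFun-zero : ∀ k n (G : (Fin k → Fin n) → Carrier) → (∀ t → G t ≈ 0#) → sumFun k n G ≈ 0#
  sumFun-zero zero    n G G≈0 = G≈0 _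
  sumFun-zero (suc k) n G G≈0 = sumFin-zero n _ (λ a → sumFun-zero k n _ (λ g → G≈0 _))

  sumFun-delta : ∀ k n (G : (Fin k → Fin n) → Carrier) (t₀ : Fin k → Fin n) {v} →
                 (∀ t → ¬ t ≗ t₀ → G t ≈ 0#) → (∀ t → t ≗ t₀ → G t ≈ v) →
                 sumFun k n G ≈ v
  sumFun-delta zero    n G t₀ off on = on _ (λ ())
  sumFun-delta (suc k) n G t₀ off on = ≈-trans
    (sumFin-delta n _ (t₀ zero)
      (λ a a≢t₀0 → sumFun-zero k n _ (λ g → off _ (λ t≗t₀ → a≢t₀0 (t≗t₀ zero)))))
    (sumFun-delta k n _ (t₀ ∘ suc)
      (λ g g≉ → off _ (λ t≗t₀ → g≉ (t≗t₀ ∘ suc)))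
      (λ g g≗ → on _ λ { zero → refl ; (suc i) → g≗ i }))

  -- sumX keeps its summand in a where-clause; exhibiting it as a witness
  -- lets us analyse it by cases on distinct?.
  summand : ∀ {k n} (f : Tuple k n → Carrier) → ∃ λ G → sumX k n f ≡ sumFun k n G
  summand f = _ , refl

  sumX-delta : ∀ {k n} (f : Tuple k n → Carrier) (u : Tuple k n) {v} →
               (∀ y → ¬ y ≐ u → f y ≈ 0#) → (∀ y → y ≐ u → f y ≈ v) →
               sumX k n f ≈ v
  sumX-delta {k} {n} f u {v} off on = sumFun-delta k n G (proj₁ u) off′ on′
    where
    G : (Fin k → Fin n) → Carrier
    G = proj₁ (summand f)

    off′ : ∀ t → ¬ t ≗ proj₁ u → G t ≈ 0#
    off′ t t≉u with distinct? t
    ... | yes d = off (t , d) t≉u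
    ... | no  _ = ≈-refl

    on′ : ∀ t → t ≗ proj₁ u → G t ≈ v
    on′ t t≗u with distinct? t
    ... | yes d  = on (t , d) t≗u
    ... | no  ¬d = ⊥-elim (¬d λ i j tᵢ≡tⱼ →
                     proj₂ u i j (trans (sym (t≗u i)) (trans tᵢ≡tⱼ (t≗u j))))

  permutationMatrix : ∀ {k n} → (Tuple k n → Tuple k n) → Mat k n
  permutationMatrix f x y = [ sameTuple? x (f y) ]

  module _ {k n : ℕ} where

    Congruent : (Tuple k n → Tuple k n) → Set
    Congruent f = ∀ {x y} → x ≐ y → f x ≐ f y

    permutationMatrix-cong : ∀ (f g : Tuple k n → Tuple k n) → (∀ y → f y ≐ g y) →
                             permutationMatrix f ≋ permutationMatrix g
    permutationMatrix-cong f g f≐g x y =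
      iverson-cong (sameTuple? x (f y)) (sameTuple? x (g y))
        (λ x≐fy → ≗-trans x≐fy (f≐g y)) (λ x≐gy → ≗-trans x≐gy (≗-sym (f≐g y)))

    permutationMatrix-congʳ : ∀ (f : Tuple k n → Tuple k n) → Congruent f →
                              ∀ x {y y′} → y ≐ y′ →
                              permutationMatrix f x y ≈ permutationMatrix f x y′
    permutationMatrix-congʳ f f-cong x {y} {y′} y≐y′ =
      iverson-cong (sameTuple? x (f y)) (sameTuple? x (f y′))
        (λ x≐fy  → ≗-trans x≐fy  (f-cong y≐y′))
        (λ x≐fy′ → ≗-trans x≐fy′ (f-cong (≗-sym y≐y′)))

    ⊗-permutationMatrix : (A : Mat k n) (g : Tuple k n → Tuple k n) →
                          (∀ x {y y′} → y ≐ y′ → A x y ≈ A x y′) →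
                          (A ⊗ permutationMatrix g) ≋ (λ x z → A x (g z))
    ⊗-permutationMatrix A g A-congʳ x z = sumX-delta _ (g z)
      (λ y y≉gz → begin
        A x y * [ sameTuple? y (g z) ] ≈⟨ *-congˡ (iverson-no (sameTuple? y (g z)) y≉gz) ⟩
        A x y * 0#                     ≈⟨ zeroʳ (A x y) ⟩
        0#                             ∎)
      (λ y y≐gz → begin
        A x y * [ sameTuple? y (g z) ] ≈⟨ *-cong (A-congʳ x y≐gz)
                                                 (iverson-yes (sameTuple? y (g z)) y≐gz) ⟩
        A x (g z) * 1#                 ≈⟨ *-identityʳ (A x (g z)) ⟩
        A x (g z)                      ∎)

    permutationMatrix-⊗ : ∀ (f g : Tuple k n → Tuple k n) → Congruent f →
                          (permutationMatrix f ⊗ permutationMatrix g) ≋ permutationMatrix (f ∘ g)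
    permutationMatrix-⊗ f g f-cong =
      ⊗-permutationMatrix (permutationMatrix f) g (permutationMatrix-congʳ f f-cong)

  intertwiner⇒similar : ∀ {k n} {π σ : Sym n} → TupleIntertwiner k π σ →
                        Similar (ρ k π) (ρ k σ)
  intertwiner⇒similar {k} {n} {π} {σ} I =
    P , Q , inverse to from to-cong to-from , inverse from to from-cong from-to , PρQ≋ρσ
    where
    open TupleIntertwiner I

    P Q : Mat k n
    P = permutationMatrix to
    Q = permutationMatrix from

    inverse : ∀ f g → Congruent f → (∀ x → f (g x) ≐ x) →
              (permutationMatrix f ⊗ permutationMatrix g) ≋ Id
    inverse f g f-cong f∘g≐id x z =
      ≈-trans (permutationMatrix-⊗ f g f-cong x z) (permutationMatrix-cong (f ∘ g) id f∘g≐id x z)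

    to∘π-cong : Congruent (to ∘ act π)
    to∘π-cong {x} {y} x≐y = to-cong {act π x} {act π y} (act-cong π {x} {y} x≐y)

    Pρ-congʳ : ∀ x {y y′} → y ≐ y′ → (P ⊗ ρ k π) x y ≈ (P ⊗ ρ k π) x y′
    Pρ-congʳ x {y} {y′} y≐y′ = begin
      (P ⊗ ρ k π) x y                      ≈⟨ permutationMatrix-⊗ to (act π) to-cong x y ⟩
      permutationMatrix (to ∘ act π) x y   ≈⟨ permutationMatrix-congʳ (to ∘ act π)
                                                (λ {x} {y} → to∘π-cong {x} {y}) x {y} {y′} y≐y′ ⟩
      permutationMatrix (to ∘ act π) x y′  ≈⟨ permutationMatrix-⊗ to (act π) to-cong x y′ ⟨
      (P ⊗ ρ k π) x y′                     ∎

    PρQ≋ρσ : ((P ⊗ ρ k π) ⊗ Q) ≋ ρ k σ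
    PρQ≋ρσ x z = begin
      ((P ⊗ ρ k π) ⊗ Q) x z                      ≈⟨ ⊗-permutationMatrix _ from Pρ-congʳ x z ⟩
      (P ⊗ ρ k π) x (from z)                     ≈⟨ permutationMatrix-⊗ to (act π) to-cong x (from z) ⟩
      permutationMatrix (to ∘ act π ∘ from) x z  ≈⟨ permutationMatrix-cong
                                                      (to ∘ act π ∘ from) (act σ) to∘π∘from≐σ x z ⟩
      ρ k σ x z                                  ∎
      where
      to∘π∘from≐σ : ∀ z → to (act π (from z)) ≐ act σ z
      to∘π∘from≐σ z = ≗-trans (intertwines (from z)) (act-cong σ {to (from z)} {z} (to-from z))

AtMostOneFixedPoint : ∀ {n} → Sym n → Set
AtMostOneFixedPoint π = ∀ {a b} → π ⟨$⟩ʳ a ≡ a → π ⟨$⟩ʳ b ≡ b → a ≡ b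

conjugate-atMostOneFixedPoint : ∀ {n} {π σ : Sym n} → Conjugate π σ →
                                AtMostOneFixedPoint π → AtMostOneFixedPoint σ
conjugate-atMostOneFixedPoint {π = π} {σ} (τ , σ≡τπτ⁻¹) π-unique {a} {b} σa≡a σb≡b = begin
  a                  ≡⟨ inverseʳ τ ⟨
  τ ⟨$⟩ʳ (τ ⟨$⟩ˡ a)  ≡⟨ cong (τ ⟨$⟩ʳ_) (π-unique (fixedBy-π σa≡a) (fixedBy-π σb≡b)) ⟩
  τ ⟨$⟩ʳ (τ ⟨$⟩ˡ b)  ≡⟨ inverseʳ τ ⟩
  b                  ∎
  where
  open ≡-Reasoning
  fixedBy-π : ∀ {v} → σ ⟨$⟩ʳ v ≡ v → π ⟨$⟩ʳ (τ ⟨$⟩ˡ v) ≡ τ ⟨$⟩ˡ v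
  fixedBy-π {v} σv≡v = begin
    π ⟨$⟩ʳ (τ ⟨$⟩ˡ v)                   ≡⟨ inverseˡ τ ⟨
    τ ⟨$⟩ˡ (τ ⟨$⟩ʳ (π ⟨$⟩ʳ (τ ⟨$⟩ˡ v)))  ≡⟨ cong (τ ⟨$⟩ˡ_) (σ≡τπτ⁻¹ v) ⟨
    τ ⟨$⟩ˡ (σ ⟨$⟩ʳ v)                   ≡⟨ cong (τ ⟨$⟩ˡ_) σv≡v ⟩
    τ ⟨$⟩ˡ v                            ∎

data Side : Set where
  lower upper unpaired : Side

swapSide : Side → Side
swapSide lower    = upper
swapSide upper    = lower
swapSide unpaired = unpaired

swapSide-fixed : ∀ {s} → swapSide s ≡ s → s ≡ unpaired
swapSide-fixed {unpaired} _ = refl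

_orElse_ : Side → Side → Side
lower    orElse _ = lower
upper    orElse _ = upper
unpaired orElse s = s

swapSide-orElse : ∀ s s′ → swapSide s orElse swapSide s′ ≡ swapSide (s orElse s′)
swapSide-orElse lower    _ = refl
swapSide-orElse upper    _ = refl
swapSide-orElse unpaired _ = refl

orElse≡unpaired : ∀ {s s′} → s orElse s′ ≡ unpaired → s ≡ unpaired × s′ ≡ unpaired
orElse≡unpaired {unpaired} s′≡unpaired = refl , s′≡unpaired

leading : ∀ {k} → (Fin k → Side) → Side
leading {zero}  _ = unpaired
leading {suc k} s = s zero orElse leading (s ∘ suc)

leading-cong : ∀ {k} {s s′ : Fin k → Side} → s ≗ s′ → leading s ≡ leading s′
leading-cong {zero}  _     = refl
leading-cong {suc k} s≗s′ = cong₂ _orElse_ (s≗s′ zero) (leading-cong (s≗s′ ∘ suc))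

leading-swapSide : ∀ {k} (s : Fin k → Side) → leading (swapSide ∘ s) ≡ swapSide (leading s)
leading-swapSide {zero}  _ = refl
leading-swapSide {suc k} s =
  trans (cong (swapSide (s zero) orElse_) (leading-swapSide (s ∘ suc)))
        (swapSide-orElse (s zero) (leading (s ∘ suc)))

leading≡unpaired : ∀ {k} (s : Fin k → Side) → leading s ≡ unpaired → ∀ i → s i ≡ unpaired
leading≡unpaired {suc k} s eq zero    = proj₁ (orElse≡unpaired eq)
leading≡unpaired {suc k} s eq (suc i) = leading≡unpaired (s ∘ suc) (proj₂ (orElse≡unpaired eq)) i

module LeadingSideSwap
  {n} (π σ t : Sym n) (side : Fin n → Side)
  (t-involutive : ∀ v → t ⟨$⟩ʳ (t ⟨$⟩ʳ v) ≡ v)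
  (t∘π≗σ : ∀ v → t ⟨$⟩ʳ (π ⟨$⟩ʳ v) ≡ σ ⟨$⟩ʳ v)
  (σ∘t≗π : ∀ v → σ ⟨$⟩ʳ (t ⟨$⟩ʳ v) ≡ π ⟨$⟩ʳ v)
  (side-π : ∀ v → side (π ⟨$⟩ʳ v) ≡ swapSide (side v))
  (side-t : ∀ v → side (t ⟨$⟩ʳ v) ≡ side v)
  {k} (hasPairedEntry : ∀ (x : Tuple k n) → leading (side ∘ proj₁ x) ≢ unpaired)
  where

  open import Relation.Binary.Reasoning.Setoid (Tuple-setoid k n)

  leadingSide : Tuple k n → Side
  leadingSide x = leading (side ∘ proj₁ x)

  leadingSide-cong : ∀ {x y} → x ≐ y → leadingSide x ≡ leadingSide y
  leadingSide-cong x≐y = leading-cong (cong side ∘ x≐y)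

  leadingSide-π : ∀ x → leadingSide (act π x) ≡ swapSide (leadingSide x)
  leadingSide-π x = trans (leading-cong (side-π ∘ proj₁ x)) (leading-swapSide (side ∘ proj₁ x))

  leadingSide-t : ∀ x → leadingSide (act t x) ≡ leadingSide x
  leadingSide-t x = leading-cong (side-t ∘ proj₁ x)

  orient : Side → Tuple k n → Tuple k n
  orient lower    x = x
  orient upper    x = act t x
  orient unpaired x = x

  orient-cong : ∀ s {x y} → x ≐ y → orient s x ≐ orient s y
  orient-cong lower          x≐y = x≐y
  orient-cong upper {x} {y} x≐y = act-cong t {x} {y} x≐y
  orient-cong unpaired       x≐y = x≐y

  τ : Tuple k n → Tuple k n
  τ x = orient (leadingSide x) x

  τ-at : ∀ {x} s → leadingSide x ≡ s → τ x ≡ orient s x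
  τ-at {x} s eq = cong (λ s → orient s x) eq

  τ-cong : ∀ {x y} → x ≐ y → τ x ≐ τ y
  τ-cong {x} {y} x≐y = begin
    τ x                       ≡⟨ τ-at (leadingSide y) (leadingSide-cong {x} {y} x≐y) ⟩
    orient (leadingSide y) x  ≈⟨ orient-cong (leadingSide y) x≐y ⟩
    τ y                       ∎

  τ-involutive : ∀ x → τ (τ x) ≐ x
  τ-involutive x = involutive-at (leadingSide x) refl
    where
    involutive-at : ∀ s → leadingSide x ≡ s → τ (τ x) ≐ x
    involutive-at lower eq = begin
      τ (τ x)          ≡⟨ cong τ (τ-at lower eq) ⟩
      τ x              ≡⟨ τ-at lower eq ⟩
      x                ∎
    involutive-at upper eq = begin
      τ (τ x)          ≡⟨ cong τ (τ-at upper eq) ⟩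
      τ (act t x)      ≡⟨ τ-at upper (trans (leadingSide-t x) eq) ⟩
      act t (act t x)  ≈⟨ t-involutive ∘ proj₁ x ⟩
      x                ∎
    involutive-at unpaired eq = ⊥-elim (hasPairedEntry x eq)

  τ-intertwines : ∀ x → τ (act π x) ≐ act σ (τ x)
  τ-intertwines x = intertwines-at (leadingSide x) refl
    where
    intertwines-at : ∀ s → leadingSide x ≡ s → τ (act π x) ≐ act σ (τ x)
    intertwines-at lower eq = begin
      τ (act π x)      ≡⟨ τ-at upper (trans (leadingSide-π x) (cong swapSide eq)) ⟩
      act t (act π x)  ≈⟨ t∘π≗σ ∘ proj₁ x ⟩
      act σ x          ≡⟨ cong (act σ) (τ-at lower eq) ⟨
      act σ (τ x)      ∎
    intertwines-at upper eq = begin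
      τ (act π x)      ≡⟨ τ-at lower (trans (leadingSide-π x) (cong swapSide eq)) ⟩
      act π x          ≈⟨ ≗-sym (σ∘t≗π ∘ proj₁ x) ⟩
      act σ (act t x)  ≡⟨ cong (act σ) (τ-at upper eq) ⟨
      act σ (τ x)      ∎
    intertwines-at unpaired eq = ⊥-elim (hasPairedEntry x eq)

  intertwiner : TupleIntertwiner k π σ
  intertwiner = record
    { to          = τ
    ; from        = τ
    ; to-cong     = τ-cong
    ; from-cong   = τ-cong
    ; to-from     = τ-involutive
    ; from-to     = τ-involutive
    ; intertwines = τ-intertwines
    }

distinctTuple-notWithin : ∀ {k n m} (P : Fin n → Set) (slot : Fin n → Fin m) →
                          (∀ {u v} → P u → P v → slot u ≡ slot v → u ≡ v) → m < k →
                          (x : Tuple k n) → ¬ (∀ i → P (proj₁ x i))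
distinctTuple-notWithin P slot slot-injective m<k (s , distinct) all-P
  with i , j , i<j , slotᵢ≡slotⱼ ← pigeonhole m<k (slot ∘ s)
  = <⇒≢ i<j (distinct i j (slot-injective (all-P i) (all-P j) slotᵢ≡slotⱼ))

swapPairs : ∀ {m} → Fin m → Fin m
swapPairs {1}    zero          = zero
swapPairs {2+ _} zero          = suc zero
swapPairs {2+ _} (suc zero)    = zero
swapPairs {2+ _} (suc (suc i)) = suc (suc (swapPairs i))

pairSide : ∀ {m} → Fin m → Side
pairSide {1}    zero          = unpaired
pairSide {2+ _} zero          = lower
pairSide {2+ _} (suc zero)    = upper
pairSide {2+ _} (suc (suc i)) = pairSide i

swapPairs-involutive : ∀ {m} (i : Fin m) → swapPairs (swapPairs i) ≡ i
swapPairs-involutive {1}    zero          = refl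
swapPairs-involutive {2+ _} zero          = refl
swapPairs-involutive {2+ _} (suc zero)    = refl
swapPairs-involutive {2+ _} (suc (suc i)) = cong (λ i → suc (suc i)) (swapPairs-involutive i)

pairSide-swapPairs : ∀ {m} (i : Fin m) → pairSide (swapPairs i) ≡ swapSide (pairSide i)
pairSide-swapPairs {1}    zero          = refl
pairSide-swapPairs {2+ _} zero          = refl
pairSide-swapPairs {2+ _} (suc zero)    = refl
pairSide-swapPairs {2+ _} (suc (suc i)) = pairSide-swapPairs i

unpaired-unique : ∀ {m} {i j : Fin m} → pairSide i ≡ unpaired → pairSide j ≡ unpaired → i ≡ j
unpaired-unique {1}    {zero}        {zero}        _ _ = refl
unpaired-unique {2+ _} {suc (suc i)} {suc (suc j)} p q =
  cong (λ i → suc (suc i)) (unpaired-unique {i = i} {j} p q)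

swapPairs-fixed⇒unpaired : ∀ {m} {i : Fin m} → swapPairs i ≡ i → pairSide i ≡ unpaired
swapPairs-fixed⇒unpaired {i = i} fixed =
  swapSide-fixed (trans (sym (pairSide-swapPairs i)) (cong pairSide fixed))

involution : ∀ {n} (f : Fin n → Fin n) → (∀ i → f (f i) ≡ i) → Sym n
involution f f-involutive = permutation f f f-involutive f-involutive

swapPairs-atMostOneFixedPoint : ∀ {m} →
                                AtMostOneFixedPoint (involution {m} swapPairs swapPairs-involutive)
swapPairs-atMostOneFixedPoint fa fb =
  unpaired-unique (swapPairs-fixed⇒unpaired fa) (swapPairs-fixed⇒unpaired fb)

module _ {m : ℕ} where

  swap01 : Fin (2+ m) → Fin (2+ m)
  swap01 zero          = suc zero
  swap01 (suc zero)    = zero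
  swap01 (suc (suc i)) = suc (suc i)

  swapPairsAbove1 : Fin (2+ m) → Fin (2+ m)
  swapPairsAbove1 = swap01 ∘ swapPairs

  sideAbove1 : Fin (2+ m) → Side
  sideAbove1 zero          = unpaired
  sideAbove1 (suc zero)    = unpaired
  sideAbove1 (suc (suc i)) = pairSide i

  swap01-involutive : ∀ i → swap01 (swap01 i) ≡ i
  swap01-involutive zero          = refl
  swap01-involutive (suc zero)    = refl
  swap01-involutive (suc (suc i)) = refl

  swapPairsAbove1-involutive : ∀ i → swapPairsAbove1 (swapPairsAbove1 i) ≡ i
  swapPairsAbove1-involutive zero          = refl
  swapPairsAbove1-involutive (suc zero)    = refl
  swapPairsAbove1-involutive (suc (suc i)) = cong (λ i → suc (suc i)) (swapPairs-involutive i)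

  swapPairsAbove1∘swap01 : ∀ i → swapPairsAbove1 (swap01 i) ≡ swapPairs i
  swapPairsAbove1∘swap01 zero          = refl
  swapPairsAbove1∘swap01 (suc zero)    = refl
  swapPairsAbove1∘swap01 (suc (suc i)) = refl

  sideAbove1-swapPairs : ∀ i → sideAbove1 (swapPairs i) ≡ swapSide (sideAbove1 i)
  sideAbove1-swapPairs zero          = refl
  sideAbove1-swapPairs (suc zero)    = refl
  sideAbove1-swapPairs (suc (suc i)) = pairSide-swapPairs i

  sideAbove1-swap01 : ∀ i → sideAbove1 (swap01 i) ≡ sideAbove1 i
  sideAbove1-swap01 zero          = refl
  sideAbove1-swap01 (suc zero)    = refl
  sideAbove1-swap01 (suc (suc i)) = refl

  slot : Fin (2+ m) → Fin 3
  slot zero          = zero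
  slot (suc zero)    = suc zero
  slot (suc (suc _)) = suc (suc zero)

  slot-injective : ∀ {u v} → sideAbove1 u ≡ unpaired → sideAbove1 v ≡ unpaired →
                   slot u ≡ slot v → u ≡ v
  slot-injective {zero}        {zero}        _ _ _  = refl
  slot-injective {suc zero}    {suc zero}    _ _ _  = refl
  slot-injective {suc (suc i)} {suc (suc j)} p q _  =
    cong (λ i → suc (suc i)) (unpaired-unique {i = i} {j} p q)
  slot-injective {zero}        {suc zero}    _ _ ()
  slot-injective {zero}        {suc (suc _)} _ _ ()
  slot-injective {suc zero}    {zero}        _ _ ()
  slot-injective {suc zero}    {suc (suc _)} _ _ ()
  slot-injective {suc (suc _)} {zero}        _ _ ()
  slot-injective {suc (suc _)} {suc zero}    _ _ ()

  hasPairedEntry : ∀ {k} → 3 < k → (x : Tuple k (2+ m)) →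
                   leading (sideAbove1 ∘ proj₁ x) ≢ unpaired
  hasPairedEntry 3<k x noPairedEntry =
    distinctTuple-notWithin (λ v → sideAbove1 v ≡ unpaired) slot slot-injective 3<k x
      (leading≡unpaired (sideAbove1 ∘ proj₁ x) noPairedEntry)

  π σ t : Sym (2+ m)
  π = involution swapPairs swapPairs-involutive
  σ = involution swapPairsAbove1 swapPairsAbove1-involutive
  t = involution swap01 swap01-involutive

  π≁σ : ¬ Conjugate π σ
  π≁σ π∼σ
    with () ← conjugate-atMostOneFixedPoint {π = π} {σ} π∼σ swapPairs-atMostOneFixedPoint
                {zero} {suc zero} refl refl

  ρπ-similar-ρσ : ∀ {c ℓ} (F : CommutativeRing c ℓ) {k} → 3 < k →
                  Matrices.Similar F (Matrices.ρ F k π) (Matrices.ρ F k σ)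
  ρπ-similar-ρσ F 3<k = PermutationMatrices.intertwiner⇒similar F
    (LeadingSideSwap.intertwiner π σ t sideAbove1
      swap01-involutive (λ _ → refl) swapPairsAbove1∘swap01 sideAbove1-swapPairs sideAbove1-swap01
      (hasPairedEntry 3<k))

-- The field hypotheses are unused: permutation matrices are invertible over any commutative ring.
theorem3p11 : ∀ {c ℓ : Level} (F : CommutativeRing c ℓ) → Matrices.IsAlgClosedFieldChar0 F →
    (k n : ℕ) → 4 ≤ k → k ≤ n →
    ∃ λ (π : Sym n) → ∃ λ (σ : Sym n) →
      (¬ Conjugate π σ) × Matrices.Similar F (Matrices.ρ F k π) (Matrices.ρ F k σ)
theorem3p11 F _ k n 4≤k k≤n with ≤-trans 4≤k k≤n
... | s≤s (s≤s _) = π , σ , π≁σ , ρπ-similar-ρσ F 4≤k
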